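{- Let $n\geq 3$ and $s\geq 1$ be integers with $s^2\equiv 1\pmod n$ and $s\not\equiv 1\pmod n$, let $G=D_{n,s}=\langle a,b\mid a^n=b^2=1,\ bab^{ -1}=a^s\rangle$ and $\tau=\gcd(s-1,n)$. Then the centralizer algebra $\widetilde{T}(G)$ satisfies $$\dim_{\mathbb{C}}\widetilde{T}(G)=\frac{n^2+3n\tau+4\tau^2}{2}.$$
   Context: For a finite group $G$, let $\mathfrak{X}:G\to \mathrm{GL}_{|G|}(\mathbb{C})$ be the permutation representation of $G$ acting on itself by conjugation: $\mathfrak{X}(g)_{u,v}=1$ if $v=gug^{ -1}$ and $0$ otherwise ($u,v\in G$). The centralizer algebra is $\widetilde{T}(G)=\{A\in M_{|G|}(\mathbb{C})\mid \mathfrak{X}(g)A=A\mathfrak{X}(g)\text{ for all } g\in G\}$; equivalently, it is the span of the $0/1$ matrices $B_i$ indexed by $G\times G$ that are indicator matrices of the orbits of $G$ acting on $G\times G$ by componentwise conjugation. -}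

module Defs where

open import Data.Nat using (ℕ; zero; suc; _+_; _*_; _∸_; _≤ᵇ_; NonZero)
open import Data.Nat.DivMod using (_%_)
open import Data.Bool using (Bool)
open import Data.Product using (_×_; _,_)
open import Data.List using (List; map; concatMap; upTo; length; filterᵇ)
open import Data.Bool.ListAction using (and)

-- The group D_{n,s} = ⟨a, b | a^n = b^2 = 1, b a b⁻¹ = a^s⟩ (with s² ≡ 1 mod n)
-- is modelled concretely as the semidirect product Z_n ⋊ Z_2:
-- the element a^i b^j is the pair (i , j) with i < n and j < 2.
Elt : Set
Elt = ℕ × ℕ

module Dns (n s : ℕ) .{{_ : NonZero n}} where

  elements : List Elt
  elements = concatMap (λ j → map (λ i → (i , j)) (upTo n)) (upTo 2)

  sp : ℕ → ℕ
  sp zero    = 1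
  sp (suc _) = s

  -- (a^i b^j)(a^k b^l) = a^(i + s^j k) b^(j + l), since b a^k = a^(s k) b
  _·_ : Elt → Elt → Elt
  (i , j) · (k , l) = ((i + sp j * k) % n , (j + l) % 2)

  -- (a^i b^j)⁻¹ = a^(-s^j i) b^j  (uses s² ≡ 1 mod n when j = 1)
  inv : Elt → Elt
  inv (i , j) = ((sp j * (n ∸ i)) % n , j)

  conj : Elt → Elt → Elt
  conj g u = (g · u) · inv g

  act : Elt → Elt × Elt → Elt × Elt
  act g (u , v) = (conj g u , conj g v)

  pairs : List (Elt × Elt)
  pairs = concatMap (λ u → map (λ v → (u , v)) elements) elements

  code : Elt → ℕ
  code (i , j) = i + n * j

  pairCode : Elt × Elt → ℕ
  pairCode (u , v) = code u * (2 * n) + code v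

  isOrbitRep : Elt × Elt → Bool
  isOrbitRep x = and (map (λ g → pairCode x ≤ᵇ pairCode (act g x)) elements)

  -- number of orbits of G on G × G under componentwise conjugation
  -- = number of orbit indicator matrices B_i, which span T̃(G) and are
  -- linearly independent (disjoint supports); hence = dim_ℂ T̃(G).
  dimCentralizerAlgebra : ℕ
  dimCentralizerAlgebra = length (filterᵇ isOrbitRep pairs)

{-# OPTIONS --safe #-}
module Submission where

-- Count the orbits through their representatives of least code. Conjugation preserves the
-- kind of an element (rotation a^i or reflection a^i b), so comparing codes along an orbit is
-- comparing exponent pairs lexicographically. The a-conjugates of a^i b are the a^m b with
-- m ≡ i (mod τ), so a^i b is least in its class iff i < τ. On exponents, conjugation by a
-- reflection acts on rotations by σ x = s x, and a^c b acts on reflections by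
-- x ↦ s x − (s − 1) c. Both are involutions φ of ℤ/n with τ fixed points (the solutions of
-- (s − 1) x ≡ (s − 1) c), so exactly L = (n + τ)/2 points satisfy x ≤ φ x. The four kinds of
-- pairs contribute n (L − τ) + τ L, L τ, τ L and τ L representatives; twice the sum is the formula.

open import Defs
open import Data.Bool using (Bool; true; false; T)
open import Data.Bool.Properties using (T?)
open import Data.Empty using (⊥-elim)
open import Data.Fin using (Fin; toℕ; fromℕ<)
open import Data.Fin.Permutation using (permutation)
open import Data.Fin.Properties using (toℕ<n; toℕ-fromℕ<; toℕ-injective)
open import Data.List using (List; []; _∷_; map; concat; concatMap; applyUpTo; upTo; length; filterᵇ)
open import Data.List.Properties using (map-∘; map-cong; map-concatMap; map-applyUpTo)
open import Data.List.Relation.Unary.All using (All; []; _∷_)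
open import Data.List.Relation.Unary.All.Properties
  using (all⁺; all⁻; concat⁺; concat⁻; map⁺; map⁻; applyUpTo⁺₁; applyUpTo⁻)
open import Data.Nat
open import Data.Nat.Coprimality using (Coprime; coprime-/gcd; coprime-divisor)
import Data.Nat.Coprimality as Coprime
open import Data.Nat.DivMod
open import Data.Nat.Divisibility
open import Data.Nat.GCD
open import Data.Nat.ListAction using (sum)
open import Data.Nat.ListAction.Properties using (sum-++)
open import Data.Nat.Properties
open import Algebra.Properties.CommutativeMonoid.Sum +-0-commutativeMonoid
  using (sum-permute; sum-cong-≗) renaming (sum to sumᵥ)
open import Algebra.Properties.CommutativeSemigroup +-commutativeSemigroup
  using (interchange)
open import Data.Nat.Solver using (module +-*-Solver)
open import Data.Product using (_×_; _,_; proj₁; proj₂; ∃)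
open import Data.Product.Relation.Binary.Lex.Strict using (×-Lex; ×-decidable)
open import Data.Sum using (_⊎_; inj₁; inj₂; [_,_])
open import Function using (_∘_; _⇔_; mk⇔; Equivalence)
open import Function.Construct.Composition using (_⇔-∘_)
open import Function.Construct.Symmetry using (⇔-sym)
open import Relation.Binary.Consequences using (wlog)
open import Relation.Binary.Definitions using (Decidable; tri<; tri≈; tri>)
open import Relation.Binary.PropositionalEquality
  using (_≡_; _≢_; refl; sym; trans; cong; cong₂; subst; subst₂; module ≡-Reasoning)
open import Relation.Nullary using (Dec; yes; no; ¬_)
open import Relation.Nullary.Decidable using (_×-dec_; _⊎-dec_)
open +-*-Solver

∑< : ℕ → (ℕ → ℕ) → ℕ
∑< zero    f = 0
∑< (suc m) f = f 0 + ∑< m (f ∘ suc)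

syntax ∑< m (λ k → e) = ∑[ k < m ] e

∑-cong : ∀ m {f g : ℕ → ℕ} → (∀ k → k < m → f k ≡ g k) → ∑< m f ≡ ∑< m g
∑-cong zero    _   = refl
∑-cong (suc m) f≡g = cong₂ _+_ (f≡g 0 z<s) (∑-cong m (λ k k<m → f≡g (suc k) (s<s k<m)))

∑-distrib-+ : ∀ m (f g : ℕ → ℕ) → ∑[ k < m ] (f k + g k) ≡ ∑< m f + ∑< m g
∑-distrib-+ zero    f g = refl
∑-distrib-+ (suc m) f g = begin
  f 0 + g 0 + ∑[ k < m ] (f (suc k) + g (suc k))  ≡⟨ cong (f 0 + g 0 +_) (∑-distrib-+ m (f ∘ suc) (g ∘ suc)) ⟩
  f 0 + g 0 + (∑< m (f ∘ suc) + ∑< m (g ∘ suc))   ≡⟨ interchange (f 0) (g 0) _ _ ⟩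
  f 0 + ∑< m (f ∘ suc) + (g 0 + ∑< m (g ∘ suc))   ∎
  where open ≡-Reasoning

*-distribˡ-∑ : ∀ m c (f : ℕ → ℕ) → ∑[ k < m ] (c * f k) ≡ c * ∑< m f
*-distribˡ-∑ zero    c f = sym (*-zeroʳ c)
*-distribˡ-∑ (suc m) c f = trans (cong (c * f 0 +_) (*-distribˡ-∑ m c (f ∘ suc))) (sym (*-distribˡ-+ c (f 0) _))

*-distribʳ-∑ : ∀ m c (f : ℕ → ℕ) → ∑[ k < m ] (f k * c) ≡ ∑< m f * c
*-distribʳ-∑ m c f = trans (∑-cong m (λ k _ → *-comm (f k) c)) (trans (*-distribˡ-∑ m c f) (*-comm c _))

∑-const : ∀ m c → ∑[ k < m ] c ≡ m * c
∑-const zero    c = refl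
∑-const (suc m) c = cong (c +_) (∑-const m c)

∑-splitAt : ∀ a b (f : ℕ → ℕ) → ∑< (a + b) f ≡ ∑< a f + ∑[ k < b ] f (a + k)
∑-splitAt zero    b f = refl
∑-splitAt (suc a) b f = trans (cong (f 0 +_) (∑-splitAt a b (f ∘ suc))) (sym (+-assoc (f 0) _ _))

∑-sumFin : ∀ m (f : ℕ → ℕ) → ∑< m f ≡ sumᵥ {m} (f ∘ toℕ)
∑-sumFin zero    f = refl
∑-sumFin (suc m) f = cong (f 0 +_) (∑-sumFin m (f ∘ suc))

∑-reindex-involution : ∀ m {σ : ℕ → ℕ} → (∀ x → x < m → σ x < m) → (∀ x → x < m → σ (σ x) ≡ x) →
                       ∀ (f : ℕ → ℕ) → ∑< m f ≡ ∑[ x < m ] f (σ x)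
∑-reindex-involution m {σ} σ< σσ f = begin
  ∑< m f                  ≡⟨ ∑-sumFin m f ⟩
  sumᵥ {m} (f ∘ toℕ)       ≡⟨ sum-permute (f ∘ toℕ) (permutation π π ππ ππ) ⟩
  sumᵥ {m} (f ∘ toℕ ∘ π)   ≡⟨ sum-cong-≗ (cong f ∘ toℕ-π) ⟩
  sumᵥ {m} (f ∘ σ ∘ toℕ)   ≡⟨ ∑-sumFin m (f ∘ σ) ⟨
  ∑[ x < m ] f (σ x)      ∎
  where
  open ≡-Reasoning
  π : Fin m → Fin m
  π i = fromℕ< (σ< (toℕ i) (toℕ<n i))
  toℕ-π : ∀ i → toℕ (π i) ≡ σ (toℕ i)
  toℕ-π i = toℕ-fromℕ< _
  ππ : ∀ i → π (π i) ≡ i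
  ππ i = toℕ-injective (trans (toℕ-π (π i)) (trans (cong σ (toℕ-π i)) (σσ (toℕ i) (toℕ<n i))))

𝟙 : ∀ {p} {P : Set p} → Dec P → ℕ
𝟙 (yes _) = 1
𝟙 (no  _) = 0

𝟙-yes : ∀ {p} {P : Set p} → P → (P? : Dec P) → 𝟙 P? ≡ 1
𝟙-yes p (yes _) = refl
𝟙-yes p (no ¬p) = ⊥-elim (¬p p)

𝟙-no : ∀ {p} {P : Set p} → ¬ P → (P? : Dec P) → 𝟙 P? ≡ 0
𝟙-no ¬p (yes p) = ⊥-elim (¬p p)
𝟙-no ¬p (no _)  = refl

𝟙-cong : ∀ {p q} {P : Set p} {Q : Set q} → P ⇔ Q → (P? : Dec P) (Q? : Dec Q) → 𝟙 P? ≡ 𝟙 Q?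
𝟙-cong P⇔Q (yes p) Q? = sym (𝟙-yes (Equivalence.to P⇔Q p) Q?)
𝟙-cong P⇔Q (no ¬p) Q? = sym (𝟙-no (¬p ∘ Equivalence.from P⇔Q) Q?)

𝟙-× : ∀ {p q} {P : Set p} {Q : Set q} (P? : Dec P) (Q? : Dec Q) → 𝟙 (P? ×-dec Q?) ≡ 𝟙 P? * 𝟙 Q?
𝟙-× (yes _) (yes _) = refl
𝟙-× (yes _) (no _)  = refl
𝟙-× (no _)  _       = refl

𝟙-⊎ : ∀ {p q} {P : Set p} {Q : Set q} → (P → ¬ Q) → (P? : Dec P) (Q? : Dec Q) → 𝟙 (P? ⊎-dec Q?) ≡ 𝟙 P? + 𝟙 Q?
𝟙-⊎ P⇒¬Q (yes p) Q? = cong suc (sym (𝟙-no (P⇒¬Q p) Q?))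
𝟙-⊎ P⇒¬Q (no _) (yes _) = refl
𝟙-⊎ P⇒¬Q (no _) (no _)  = refl

𝟙-trichotomy : ∀ a b → 𝟙 (a <? b) + 𝟙 (b <? a) + 𝟙 (a ≟ b) ≡ 1
𝟙-trichotomy a b with <-cmp a b
... | tri< a<b a≢b b≮a = cong₂ _+_ (cong₂ _+_ (𝟙-yes a<b (a <? b)) (𝟙-no b≮a (b <? a))) (𝟙-no a≢b (a ≟ b))
... | tri≈ a≮b a≡b b≮a = cong₂ _+_ (cong₂ _+_ (𝟙-no a≮b (a <? b)) (𝟙-no b≮a (b <? a))) (𝟙-yes a≡b (a ≟ b))
... | tri> a≮b a≢b b<a = cong₂ _+_ (cong₂ _+_ (𝟙-no a≮b (a <? b)) (𝟙-yes b<a (b <? a))) (𝟙-no a≢b (a ≟ b))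

𝟙-≤ : ∀ a b → 𝟙 (a ≤? b) ≡ 𝟙 (a <? b) + 𝟙 (a ≟ b)
𝟙-≤ a b = trans (𝟙-cong (mk⇔ m≤n⇒m<n∨m≡n [ <⇒≤ , ≤-reflexive ]) (a ≤? b) ((a <? b) ⊎-dec (a ≟ b)))
                (𝟙-⊎ <⇒≢ (a <? b) (a ≟ b))

∑-𝟙-× : ∀ m {p q} {P : Set p} {Q : ℕ → Set q} (P? : Dec P) (Q? : ∀ k → Dec (Q k)) →
        ∑[ k < m ] 𝟙 (P? ×-dec Q? k) ≡ 𝟙 P? * ∑[ k < m ] 𝟙 (Q? k)
∑-𝟙-× m P? Q? = trans (∑-cong m (λ k _ → 𝟙-× P? (Q? k))) (*-distribˡ-∑ m (𝟙 P?) (λ k → 𝟙 (Q? k)))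

module Involution {m} {σ : ℕ → ℕ} (σ< : ∀ x → x < m → σ x < m) (σσ : ∀ x → x < m → σ (σ x) ≡ x) where

  count< count≤ countFix : ℕ
  count<   = ∑[ x < m ] 𝟙 (x <? σ x)
  count≤   = ∑[ x < m ] 𝟙 (x ≤? σ x)
  countFix = ∑[ x < m ] 𝟙 (x ≟ σ x)

  count>≡count< : ∑[ x < m ] 𝟙 (σ x <? x) ≡ count<
  count>≡count< = begin
    ∑[ x < m ] 𝟙 (σ x <? x)              ≡⟨ ∑-reindex-involution m σ< σσ _ ⟩
    ∑[ x < m ] 𝟙 (σ (σ x) <? σ x)        ≡⟨ ∑-cong m (λ x x<m → cong (λ y → 𝟙 (y <? σ x)) (σσ x x<m)) ⟩
    count<                               ∎
    where open ≡-Reasoning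

  count<+count<+countFix : count< + count< + countFix ≡ m
  count<+count<+countFix = begin
    count< + count< + countFix
      ≡⟨ cong (λ c → count< + c + countFix) count>≡count< ⟨
    count< + ∑[ x < m ] 𝟙 (σ x <? x) + countFix
      ≡⟨ cong (_+ countFix) (∑-distrib-+ m _ _) ⟨
    ∑[ x < m ] (𝟙 (x <? σ x) + 𝟙 (σ x <? x)) + countFix
      ≡⟨ ∑-distrib-+ m _ _ ⟨
    ∑[ x < m ] (𝟙 (x <? σ x) + 𝟙 (σ x <? x) + 𝟙 (x ≟ σ x))
      ≡⟨ ∑-cong m (λ x _ → 𝟙-trichotomy x (σ x)) ⟩
    ∑[ x < m ] 1
      ≡⟨ trans (∑-const m 1) (*-identityʳ m) ⟩
    m ∎
    where open ≡-Reasoning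

  count≤≡count<+countFix : count≤ ≡ count< + countFix
  count≤≡count<+countFix = trans (∑-cong m (λ x _ → 𝟙-≤ x (σ x))) (∑-distrib-+ m _ _)

  count≤+count≤ : count≤ + count≤ ≡ m + countFix
  count≤+count≤ = begin
    count≤ + count≤                                    ≡⟨ cong₂ _+_ count≤≡count<+countFix count≤≡count<+countFix ⟩
    count< + countFix + (count< + countFix)            ≡⟨ solve 2 (λ a f → a :+ f :+ (a :+ f) := a :+ a :+ f :+ f) refl count< countFix ⟩
    count< + count< + countFix + countFix              ≡⟨ cong (_+ countFix) count<+count<+countFix ⟩
    m + countFix                                       ∎
    where open ≡-Reasoning

count-< : ∀ {T m} → T ≤ m → ∑[ x < m ] 𝟙 (x <? T) ≡ T
count-< {T} {m} T≤m = begin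
  ∑[ x < m ] 𝟙 (x <? T)
    ≡⟨ cong (λ m → ∑[ x < m ] 𝟙 (x <? T)) (m+[n∸m]≡n T≤m) ⟨
  ∑[ x < T + (m ∸ T) ] 𝟙 (x <? T)
    ≡⟨ ∑-splitAt T (m ∸ T) _ ⟩
  ∑[ x < T ] 𝟙 (x <? T) + ∑[ k < m ∸ T ] 𝟙 (T + k <? T)
    ≡⟨ cong₂ _+_ (∑-cong T (λ x x<T → 𝟙-yes x<T (x <? T))) (∑-cong (m ∸ T) (λ k _ → 𝟙-no (m+n≮m T k) (T + k <? T))) ⟩
  ∑[ x < T ] 1 + ∑[ k < m ∸ T ] 0
    ≡⟨ cong₂ _+_ (trans (∑-const T 1) (*-identityʳ T)) (trans (∑-const (m ∸ T) 0) (*-zeroʳ (m ∸ T))) ⟩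
  T + 0
    ≡⟨ +-identityʳ T ⟩
  T ∎
  where open ≡-Reasoning

count-≟ : ∀ {q c} → c < q → ∑[ x < q ] 𝟙 (x ≟ c) ≡ 1
count-≟ {suc q} {zero}  _         = cong suc (trans (∑-cong q (λ k _ → 𝟙-no (λ ()) (suc k ≟ 0)))
                                                    (trans (∑-const q 0) (*-zeroʳ q)))
count-≟ {suc q} {suc c} (s<s c<q) = trans (∑-cong q (λ k _ → 𝟙-cong (mk⇔ suc-injective (cong suc)) (suc k ≟ suc c) (k ≟ c)))
                                          (count-≟ c<q)

count-%-≟ : ∀ {q c} .{{_ : NonZero q}} t → c < q → ∑[ x < t * q ] 𝟙 (x % q ≟ c) ≡ t
count-%-≟ zero c<q = refl
count-%-≟ {q} {c} (suc t) c<q = begin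
  ∑[ x < q + t * q ] 𝟙 (x % q ≟ c)                                   ≡⟨ ∑-splitAt q (t * q) _ ⟩
  ∑[ x < q ] 𝟙 (x % q ≟ c) + ∑[ k < t * q ] 𝟙 ((q + k) % q ≟ c)     ≡⟨ cong₂ _+_ first-period later-periods ⟩
  1 + t                                                              ∎
  where
  open ≡-Reasoning
  first-period : ∑[ x < q ] 𝟙 (x % q ≟ c) ≡ 1
  first-period = trans (∑-cong q (λ x x<q → cong (λ y → 𝟙 (y ≟ c)) (m<n⇒m%n≡m x<q))) (count-≟ c<q)
  later-periods : ∑[ k < t * q ] 𝟙 ((q + k) % q ≟ c) ≡ t
  later-periods = trans (∑-cong (t * q) (λ k _ → cong (λ y → 𝟙 (y ≟ c)) (trans (cong (_% q) (+-comm q k)) ([m+n]%n≡m%n k q))))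
                        (count-%-≟ t c<q)

module Congruence (n : ℕ) .{{_ : NonZero n}} where

  infix 4 _≋_
  _≋_ : ℕ → ℕ → Set
  a ≋ b = a % n ≡ b % n

  %-≋ : ∀ a → a % n ≋ a
  %-≋ a = m%n%n≡m%n a n

  ≡⇒≋ : ∀ {a b} → a ≡ b → a ≋ b
  ≡⇒≋ = cong (_% n)

  ≋-+ : ∀ {a b c d} → a ≋ b → c ≋ d → a + c ≋ b + d
  ≋-+ {a} {b} {c} {d} a≋b c≋d = begin
    (a + c) % n              ≡⟨ %-distribˡ-+ a c n ⟩
    (a % n + c % n) % n      ≡⟨ cong₂ (λ x y → (x + y) % n) a≋b c≋d ⟩
    (b % n + d % n) % n      ≡⟨ %-distribˡ-+ b d n ⟨
    (b + d) % n              ∎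
    where open ≡-Reasoning

  ≋-* : ∀ {a b c d} → a ≋ b → c ≋ d → a * c ≋ b * d
  ≋-* {a} {b} {c} {d} a≋b c≋d = begin
    (a * c) % n              ≡⟨ %-distribˡ-* a c n ⟩
    (a % n * (c % n)) % n    ≡⟨ cong₂ (λ x y → (x * y) % n) a≋b c≋d ⟩
    (b % n * (d % n)) % n    ≡⟨ %-distribˡ-* b d n ⟨
    (b * d) % n              ∎
    where open ≡-Reasoning

  +-*n-≋ : ∀ a k → a + k * n ≋ a
  +-*n-≋ a k = [m+kn]%n≡m%n a k n

  ≋⇒≡ : ∀ {a b} → a ≋ b → a < n → b < n → a ≡ b
  ≋⇒≡ {a} {b} a≋b a<n b<n = trans (sym (m<n⇒m%n≡m a<n)) (trans a≋b (m<n⇒m%n≡m b<n))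

  -- adding n ∸ c % n to c gives a multiple of n, which undoes the addition of c
  +-cancelʳ-≋ : ∀ {a b} c → a + c ≋ b + c → a ≋ b
  +-cancelʳ-≋ {a} {b} c a+c≋b+c = begin
    a % n                          ≡⟨ undo a ⟨
    (a + c + (n ∸ c % n)) % n      ≡⟨ ≋-+ {a + c} {b + c} a+c≋b+c refl ⟩
    (b + c + (n ∸ c % n)) % n      ≡⟨ undo b ⟩
    b % n                          ∎
    where
    open ≡-Reasoning
    undo : ∀ x → x + c + (n ∸ c % n) ≋ x
    undo x = begin
      (x + c + (n ∸ c % n)) % n         ≡⟨ ≋-+ {x + c % n} (≋-+ {x} refl (%-≋ c)) refl ⟨
      (x + c % n + (n ∸ c % n)) % n     ≡⟨ ≡⇒≋ (trans (+-assoc x _ _) (cong (x +_) (m+[n∸m]≡n (m%n≤n c n)))) ⟩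
      (x + n) % n                       ≡⟨ [m+n]%n≡m%n x n ⟩
      x % n                             ∎

  +-cancelˡ-≋ : ∀ {a b} c → c + a ≋ c + b → a ≋ b
  +-cancelˡ-≋ {a} {b} c c+a≋c+b = +-cancelʳ-≋ c (trans (≡⇒≋ (+-comm a c)) (trans c+a≋c+b (≡⇒≋ (+-comm c b))))

  +-≋⇔∣ : ∀ a d → a ≋ a + d ⇔ n ∣ d
  +-≋⇔∣ a d = mk⇔ to from
    where
    to : a ≋ a + d → n ∣ d
    to a≋a+d = m%n≡0⇒n∣m d n (trans (+-cancelˡ-≋ a (trans (sym a≋a+d) (≡⇒≋ (sym (+-identityʳ a)))))
                                        (m<n⇒m%n≡m (>-nonZero⁻¹ n)))
    from : n ∣ d → a ≋ a + d
    from n∣d = sym (%-remove-+ʳ a n∣d)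

  ≋⇔∣∣-∣ : ∀ a b → a ≋ b ⇔ n ∣ ∣ a - b ∣
  ≋⇔∣∣-∣ = wlog ≤-total swap ordered
    where
    ordered : ∀ a b → a ≤ b → a ≋ b ⇔ n ∣ ∣ a - b ∣
    ordered a b a≤b =
      subst₂ (λ b' d → a ≋ b' ⇔ n ∣ d) (m+[n∸m]≡n a≤b) (sym (m≤n⇒∣m-n∣≡n∸m a≤b)) (+-≋⇔∣ a (b ∸ a))
    swap : ∀ {a b} → a ≋ b ⇔ n ∣ ∣ a - b ∣ → b ≋ a ⇔ n ∣ ∣ b - a ∣
    swap {a} {b} a≋b⇔ = mk⇔ (λ b≋a → subst (n ∣_) (∣-∣-comm a b) (Equivalence.to a≋b⇔ (sym b≋a)))
                            (λ n∣ → sym (Equivalence.from a≋b⇔ (subst (n ∣_) (∣-∣-comm b a) n∣)))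

module Multiples (n r : ℕ) .{{_ : NonZero n}} where
  open Congruence n

  τ : ℕ
  τ = gcd r n

  instance
    τ-nonZero : NonZero τ
    τ-nonZero = ≢-nonZero (gcd[m,n]≢0 r n (inj₂ (≢-nonZero⁻¹ n)))

  τ∣n : τ ∣ n
  τ∣n = gcd[m,n]∣n r n

  τ∣r : τ ∣ r
  τ∣r = gcd[m,n]∣m r n

  %τ-invariant : ∀ {x y} k l → x + r * k ≋ y + r * l → x % τ ≡ y % τ
  %τ-invariant {x} {y} k l x+rk≋y+rl = begin
    x % τ                    ≡⟨ %-remove-+ʳ x (∣m⇒∣m*n k τ∣r) ⟨
    (x + r * k) % τ          ≡⟨ m∣n⇒o%n%m≡o%m τ n (x + r * k) τ∣n ⟨
    (x + r * k) % n % τ      ≡⟨ cong (_% τ) x+rk≋y+rl ⟩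
    (y + r * l) % n % τ      ≡⟨ m∣n⇒o%n%m≡o%m τ n (y + r * l) τ∣n ⟩
    (y + r * l) % τ          ≡⟨ %-remove-+ʳ y (∣m⇒∣m*n l τ∣r) ⟩
    y % τ                    ∎
    where open ≡-Reasoning

  r*k≋τ : ∃ λ k → r * k ≋ τ
  r*k≋τ with Bézout.identity (gcd-GCD r n)
  ... | Bézout.+- x y τ+yn≡xr = x , sym (trans (sym (+-*n-≋ τ y)) (≡⇒≋ (trans τ+yn≡xr (*-comm x r))))
  ... | Bézout.-+ x y τ+xr≡yn = x * (n ∸ 1) , (begin
    r * (x * (n ∸ 1)) % n                    ≡⟨ +-*n-≋ _ τ ⟨
    (r * (x * (n ∸ 1)) + τ * n) % n          ≡⟨ ≡⇒≋ (regroup (n ∸ 1) (sym (suc-pred n))) ⟩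
    (τ + (y * (n ∸ 1)) * n) % n              ≡⟨ +-*n-≋ τ (y * (n ∸ 1)) ⟩
    τ % n                                    ∎)
    where
    open ≡-Reasoning
    -- x r ≡ -τ (mod n), so multiplying by n - 1 ≡ -1 gives τ
    regroup : ∀ p → n ≡ suc p → r * (x * p) + τ * n ≡ τ + (y * p) * n
    regroup p refl = begin
      r * (x * p) + τ * suc p        ≡⟨ solve 4 (λ r x p t → r :* (x :* p) :+ t :* (con 1 :+ p) := (t :+ x :* r) :* p :+ t) refl r x p τ ⟩
      (τ + x * r) * p + τ            ≡⟨ cong (λ z → z * p + τ) τ+xr≡yn ⟩
      y * suc p * p + τ              ≡⟨ solve 4 (λ y m p t → y :* m :* p :+ t := t :+ y :* p :* m) refl y (suc p) p τ ⟩
      τ + y * p * suc p              ∎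

  reach-%τ : ∀ i → ∃ λ k → k < n × i % τ + r * k ≋ i
  reach-%τ i = k₀ * (i / τ) % n , m%n<n _ n , (begin
    (i % τ + r * (k₀ * (i / τ) % n)) % n      ≡⟨ ≋-+ {i % τ} refl (≋-* {r} refl (%-≋ (k₀ * (i / τ)))) ⟩
    (i % τ + r * (k₀ * (i / τ))) % n          ≡⟨ ≡⇒≋ (cong (i % τ +_) (*-assoc r k₀ (i / τ))) ⟨
    (i % τ + r * k₀ * (i / τ)) % n            ≡⟨ ≋-+ {i % τ} refl (≋-* {r * k₀} {τ} {i / τ} rk₀≋τ refl) ⟩
    (i % τ + τ * (i / τ)) % n                 ≡⟨ ≡⇒≋ (trans (cong (i % τ +_) (*-comm τ (i / τ))) (sym (m≡m%n+[m/n]*n i τ))) ⟩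
    i % n                                     ∎)
    where
    open ≡-Reasoning
    k₀ = proj₁ r*k≋τ
    rk₀≋τ = proj₂ r*k≋τ

  q : ℕ
  q = n / τ

  τ*q≡n : τ * q ≡ n
  τ*q≡n = m*[n/m]≡n τ∣n

  instance
    q-nonZero : NonZero q
    q-nonZero = ≢-nonZero (λ q≡0 → ≢-nonZero⁻¹ n (trans (sym τ*q≡n) (trans (cong (τ *_) q≡0) (*-zeroʳ τ))))

  n∣r*⇔q∣ : ∀ d → n ∣ r * d ⇔ q ∣ d
  n∣r*⇔q∣ d = mk⇔ (λ n∣rd → coprime-divisor q⊥r/τ (*-cancelˡ-∣ τ (subst₂ _∣_ (sym τ*q≡n) τr/τd≡rd n∣rd)))
                  (λ q∣d → subst₂ _∣_ τ*q≡n (sym τr/τd≡rd) (*-monoʳ-∣ τ (∣n⇒∣m*n (r / τ) q∣d)))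
    where
    q⊥r/τ : Coprime q (r / τ)
    q⊥r/τ = Coprime.sym (coprime-/gcd r n)
    τr/τd≡rd : r * d ≡ τ * (r / τ * d)
    τr/τd≡rd = trans (cong (_* d) (sym (m*[n/m]≡n τ∣r))) (*-assoc τ (r / τ) d)

  r*-≋⇔%q : ∀ x c → r * x ≋ r * c ⇔ x % q ≡ c % q
  r*-≋⇔%q x c =
    ⇔-sym (Congruence.≋⇔∣∣-∣ q x c) ⇔-∘ (n∣r*⇔q∣ ∣ x - c ∣ ⇔-∘ subst (λ d → r * x ≋ r * c ⇔ n ∣ d)
                                                                     (sym (*-distribˡ-∣-∣ r x c)) (≋⇔∣∣-∣ (r * x) (r * c)))

  count-r*≋ : ∀ c → ∑[ x < n ] 𝟙 (r * x % n ≟ r * c % n) ≡ τ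
  count-r*≋ c = begin
    ∑[ x < n ] 𝟙 (r * x % n ≟ r * c % n)    ≡⟨ ∑-cong n (λ x _ → 𝟙-cong (r*-≋⇔%q x c) _ (x % q ≟ c % q)) ⟩
    ∑[ x < n ] 𝟙 (x % q ≟ c % q)            ≡⟨ cong (λ m → ∑[ x < m ] 𝟙 (x % q ≟ c % q)) (sym τ*q≡n) ⟩
    ∑[ x < τ * q ] 𝟙 (x % q ≟ c % q)        ≡⟨ count-%-≟ τ (m%n<n c q) ⟩
    τ                                        ∎
    where open ≡-Reasoning

infix 4 _≤ₗₑₓ_ _≤ₗₑₓ?_

_≤ₗₑₓ_ : ℕ × ℕ → ℕ × ℕ → Set
_≤ₗₑₓ_ = ×-Lex _≡_ _<_ _≤_

_≤ₗₑₓ?_ : Decidable _≤ₗₑₓ_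
_≤ₗₑₓ?_ = ×-decidable _≟_ _<?_ _≤?_

lead-<⇒*+-< : ∀ {N a b c} d → b < N → a < c → a * N + b < c * N + d
lead-<⇒*+-< {N} {a} {b} {c} d b<N a<c = begin-strict
  a * N + b       <⟨ +-monoʳ-< (a * N) b<N ⟩
  a * N + N       ≡⟨ +-comm (a * N) N ⟩
  suc a * N       ≤⟨ *-monoˡ-≤ N a<c ⟩
  c * N           ≤⟨ m≤m+n (c * N) d ⟩
  c * N + d       ∎
  where open ≤-Reasoning

*+-≤⇔≤ₗₑₓ : ∀ {N a b c d} → b < N → d < N → a * N + b ≤ c * N + d ⇔ (a , b) ≤ₗₑₓ (c , d)
*+-≤⇔≤ₗₑₓ {N} {a} {b} {c} {d} b<N d<N = mk⇔ to from
  where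
  to : a * N + b ≤ c * N + d → (a , b) ≤ₗₑₓ (c , d)
  to ≤ with <-cmp a c
  ... | tri< a<c _ _    = inj₁ a<c
  ... | tri≈ _ refl _   = inj₂ (refl , +-cancelˡ-≤ (a * N) b d ≤)
  ... | tri> _ _ c<a    = ⊥-elim (<⇒≱ (lead-<⇒*+-< b d<N c<a) ≤)
  from : (a , b) ≤ₗₑₓ (c , d) → a * N + b ≤ c * N + d
  from (inj₁ a<c)          = <⇒≤ (lead-<⇒*+-< d b<N a<c)
  from (inj₂ (refl , b≤d)) = +-monoʳ-≤ (a * N) b≤d

≤ₗₑₓ-+ʳ : ∀ {a b c d} x y → (a + x , b + y) ≤ₗₑₓ (c + x , d + y) ⇔ (a , b) ≤ₗₑₓ (c , d)
≤ₗₑₓ-+ʳ {a} {b} {c} {d} x y = mk⇔ to from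
  where
  to : (a + x , b + y) ≤ₗₑₓ (c + x , d + y) → (a , b) ≤ₗₑₓ (c , d)
  to (inj₁ a+x<c+x)        = inj₁ (+-cancelʳ-< x _ _ a+x<c+x)
  to (inj₂ (a+x≡c+x , ≤))  = inj₂ (+-cancelʳ-≡ x _ _ a+x≡c+x , +-cancelʳ-≤ y _ _ ≤)
  from : (a , b) ≤ₗₑₓ (c , d) → (a + x , b + y) ≤ₗₑₓ (c + x , d + y)
  from (inj₁ a<c)          = inj₁ (+-monoˡ-< x a<c)
  from (inj₂ (refl , b≤d)) = inj₂ (refl , +-monoˡ-≤ y b≤d)

≤ₗₑₓ⇒≤₁ : ∀ {a b c d} → (a , b) ≤ₗₑₓ (c , d) → a ≤ c
≤ₗₑₓ⇒≤₁ (inj₁ a<c)        = <⇒≤ a<c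
≤ₗₑₓ⇒≤₁ (inj₂ (refl , _)) = ≤-refl

≤ₗₑₓ-intro : ∀ {a b c d} → a ≤ c → (a ≡ c → b ≤ d) → (a , b) ≤ₗₑₓ (c , d)
≤ₗₑₓ-intro a≤c b≤d with m≤n⇒m<n∨m≡n a≤c
... | inj₁ a<c = inj₁ a<c
... | inj₂ a≡c = inj₂ (a≡c , b≤d a≡c)

≤ₗₑₓ⇒≤₂ : ∀ {a b d} → (a , b) ≤ₗₑₓ (a , d) → b ≤ d
≤ₗₑₓ⇒≤₂ (inj₁ a<a)      = ⊥-elim (<-irrefl refl a<a)
≤ₗₑₓ⇒≤₂ (inj₂ (_ , b≤d)) = b≤d

length-filterᵇ : ∀ {A : Set} (p : A → Bool) xs → length (filterᵇ p xs) ≡ sum (map (λ x → 𝟙 (T? (p x))) xs)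
length-filterᵇ p []       = refl
length-filterᵇ p (x ∷ xs) with p x
... | true  = cong suc (length-filterᵇ p xs)
... | false = length-filterᵇ p xs

sum-concat : ∀ (xss : List (List ℕ)) → sum (concat xss) ≡ sum (map sum xss)
sum-concat []         = refl
sum-concat (xs ∷ xss) = trans (sum-++ xs (concat xss)) (cong (sum xs +_) (sum-concat xss))

sum-map-concatMap : ∀ {A B : Set} (F : B → ℕ) (f : A → List B) xs →
                    sum (map F (concatMap f xs)) ≡ sum (map (λ x → sum (map F (f x))) xs)
sum-map-concatMap F f xs = begin
  sum (map F (concatMap f xs))                 ≡⟨ cong sum (map-concatMap F f xs) ⟩
  sum (concat (map (map F ∘ f) xs))            ≡⟨ sum-concat (map (map F ∘ f) xs) ⟩
  sum (map sum (map (map F ∘ f) xs))           ≡⟨ cong sum (map-∘ xs) ⟨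
  sum (map (λ x → sum (map F (f x))) xs)       ∎
  where open ≡-Reasoning

sum-applyUpTo : ∀ m (f : ℕ → ℕ) → sum (applyUpTo f m) ≡ ∑< m f
sum-applyUpTo zero    f = refl
sum-applyUpTo (suc m) f = cong (f 0 +_) (sum-applyUpTo m (f ∘ suc))

sum-map-upTo : ∀ {A : Set} m (F : A → ℕ) (h : ℕ → A) → sum (map F (map h (upTo m))) ≡ ∑[ k < m ] F (h k)
sum-map-upTo m F h = trans (cong (sum ∘ map F) (map-applyUpTo (λ k → k) h m))
                           (trans (cong sum (map-applyUpTo h F m)) (sum-applyUpTo m (F ∘ h)))

dimension-arithmetic : ∀ {n L} a t → a + a + t ≡ n → a + t ≡ L →
                       2 * (n * a + t * L + L * t + (t * L + t * L)) ≡ n * n + 3 * n * t + 4 * (t * t)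
dimension-arithmetic a t refl refl =
  solve 2 (λ a t → con 2 :* ((a :+ a :+ t) :* a :+ t :* (a :+ t) :+ (a :+ t) :* t :+ (t :* (a :+ t) :+ t :* (a :+ t)))
                   := (a :+ a :+ t) :* (a :+ a :+ t) :+ con 3 :* (a :+ a :+ t) :* t :+ con 4 :* (t :* t)) refl a t

module Orbits (n r : ℕ) .{{_ : NonZero n}} (s²≋1 : (suc r * suc r) % n ≡ 1 % n) where
  open Dns n (suc r)
  open Congruence n
  open Multiples n r

  s : ℕ
  s = suc r

  σ : ℕ → ℕ
  σ x = s * x % n

  private
    %-mul-add-≋ : ∀ x y z → (x % n + y * (z % n)) % n ≋ x + y * z
    %-mul-add-≋ x y z = trans (%-≋ _) (≋-+ {x % n} (%-≋ x) (≋-* {y} refl (%-≋ z)))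

  -- As for dihedral groups, a^i = (i , 0) is called a rotation and a^i b = (i , 1) a reflection.
  conj-rotation-by-rotation : ∀ {k i} → k ≤ n → i < n → proj₁ (conj (k , 0) (i , 0)) ≡ i
  conj-rotation-by-rotation {k} {i} k≤n i<n =
    ≋⇒≡ (trans (%-mul-add-≋ (k + 1 * i) 1 (1 * (n ∸ k))) (trans (≡⇒≋ eq) (+-*n-≋ i 1))) (m%n<n _ n) i<n
    where
    eq : k + 1 * i + 1 * (1 * (n ∸ k)) ≡ i + 1 * n
    eq = trans (solve 3 (λ k i j → k :+ con 1 :* i :+ con 1 :* (con 1 :* j) := i :+ con 1 :* (k :+ j)) refl k i (n ∸ k))
               (cong (λ z → i + 1 * z) (m+[n∸m]≡n k≤n))

  conj-rotation-by-reflection : ∀ {k} i → k ≤ n → proj₁ (conj (k , 1) (i , 0)) ≡ σ i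
  conj-rotation-by-reflection {k} i k≤n = ≋⇒≡ (begin
    proj₁ (conj (k , 1) (i , 0)) % n          ≡⟨ %-mul-add-≋ (k + s * i) s (s * (n ∸ k)) ⟩
    (k + s * i + s * (s * (n ∸ k))) % n       ≡⟨ ≡⇒≋ (solve 4 (λ k s i j → k :+ s :* i :+ s :* (s :* j) := s :* i :+ k :+ s :* s :* j) refl k s i (n ∸ k)) ⟩
    (s * i + k + s * s * (n ∸ k)) % n         ≡⟨ ≋-+ {s * i + k} refl (≋-* {s * s} {1} {n ∸ k} s²≋1 refl) ⟩
    (s * i + k + 1 * (n ∸ k)) % n             ≡⟨ ≡⇒≋ (trans (solve 3 (λ a k j → a :+ k :+ con 1 :* j := a :+ con 1 :* (k :+ j)) refl (s * i) k (n ∸ k))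
                                                             (cong (λ z → s * i + 1 * z) (m+[n∸m]≡n k≤n))) ⟩
    (s * i + 1 * n) % n                       ≡⟨ +-*n-≋ (s * i) 1 ⟩
    (s * i) % n                               ≡⟨ %-≋ (s * i) ⟨
    σ i % n                                   ∎) (m%n<n _ n) (m%n<n _ n)
    where open ≡-Reasoning

  conj-reflection-by-rotation : ∀ {k} i → k ≤ n → proj₁ (conj (k , 0) (i , 1)) + r * k ≋ i
  conj-reflection-by-rotation {k} i k≤n =
    trans (≋-+ {proj₁ (conj (k , 0) (i , 1))} (%-mul-add-≋ (k + 1 * i) s (1 * (n ∸ k))) refl)
          (trans (≡⇒≋ (trans (solve 4 (λ k i j r → k :+ con 1 :* i :+ (con 1 :+ r) :* (con 1 :* j) :+ r :* k
                                                   := i :+ (con 1 :+ r) :* (k :+ j)) refl k i (n ∸ k) r)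
                             (cong (λ z → i + s * z) (m+[n∸m]≡n k≤n))))
                 (+-*n-≋ i s))

  conj-reflection-by-reflection : ∀ {k} i → k ≤ n → proj₁ (conj (k , 1) (i , 1)) + r * k ≋ s * i
  conj-reflection-by-reflection {k} i k≤n =
    trans (≋-+ {proj₁ (conj (k , 1) (i , 1))} (%-mul-add-≋ (k + s * i) 1 (s * (n ∸ k))) refl)
          (trans (≡⇒≋ (trans (solve 4 (λ k i j r → k :+ (con 1 :+ r) :* i :+ con 1 :* ((con 1 :+ r) :* j) :+ r :* k
                                                   := (con 1 :+ r) :* i :+ (con 1 :+ r) :* (k :+ j)) refl k i (n ∸ k) r)
                             (cong (λ z → s * i + s * z) (m+[n∸m]≡n k≤n))))
                 (+-*n-≋ (s * i) s))

  conj-preserves-kind : ∀ {k t i j} → t < 2 → j < 2 → proj₂ (conj (k , t) (i , j)) ≡ j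
  conj-preserves-kind {t = 0} {j = 0} _ _ = refl
  conj-preserves-kind {t = 0} {j = 1} _ _ = refl
  conj-preserves-kind {t = 1} {j = 0} _ _ = refl
  conj-preserves-kind {t = 1} {j = 1} _ _ = refl
  conj-preserves-kind {t = 2+ _} (s<s (s<s ()))
  conj-preserves-kind {j = 2+ _} _ (s<s (s<s ()))

  ConjBelow : Elt × Elt → Elt → Set
  ConjBelow ((i , j) , (i' , j')) g = (i , i') ≤ₗₑₓ (proj₁ (conj g (i , j)) , proj₁ (conj g (i' , j')))

  Minimal : Elt × Elt → Set
  Minimal x = ∀ k → k < n → ConjBelow x (k , 0) × ConjBelow x (k , 1)

  All-elements⇔ : ∀ {P : Elt → Set} → All P elements ⇔ (∀ k → k < n → P (k , 0) × P (k , 1))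
  All-elements⇔ {P} = mk⇔ to from
    where
    to : All P elements → ∀ k → k < n → P (k , 0) × P (k , 1)
    to all-P k k<n with concat⁻ {xss = map (λ j → map (λ i → (i , j)) (upTo n)) (upTo 2)} all-P
    ... | P₀ ∷ P₁ ∷ [] = applyUpTo⁻ _ n (map⁻ P₀) k<n , applyUpTo⁻ _ n (map⁻ P₁) k<n
    from : (∀ k → k < n → P (k , 0) × P (k , 1)) → All P elements
    from P₀₁ = concat⁺ (map⁺ (applyUpTo⁺₁ _ n (proj₁ ∘ P₀₁ _)) ∷ map⁺ (applyUpTo⁺₁ _ n (proj₂ ∘ P₀₁ _)) ∷ [])

  code<2n : ∀ {i j} → i < n → j < 2 → i + n * j < 2 * n
  code<2n {i} {0} i<n _ = begin-strict
    i + n * 0     ≡⟨ cong (i +_) (*-zeroʳ n) ⟩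
    i + 0         <⟨ +-monoˡ-< 0 i<n ⟩
    n + 0         ≤⟨ +-monoʳ-≤ n z≤n ⟩
    2 * n         ∎
    where open ≤-Reasoning
  code<2n {i} {1} i<n _ = begin-strict
    i + n * 1     <⟨ +-monoˡ-< (n * 1) i<n ⟩
    n + n * 1     ≡⟨ cong (n +_) (trans (*-identityʳ n) (sym (+-identityʳ n))) ⟩
    2 * n         ∎
    where open ≤-Reasoning
  code<2n {j = 2+ _} _ (s<s (s<s ()))

  pairCode-≤⇔ConjBelow : ∀ {i j i' j' k t} → i' < n → j < 2 → j' < 2 → t < 2 →
                         pairCode ((i , j) , (i' , j')) ≤ pairCode (act (k , t) ((i , j) , (i' , j')))
                         ⇔ ConjBelow ((i , j) , (i' , j')) (k , t)
  pairCode-≤⇔ConjBelow {i} {j} {i'} {j'} {k} {t} i'<n j<2 j'<2 t<2 =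
    mk⇔ (Equivalence.to lex ∘ subst (pairCode x ≤_) act-code)
        (subst (pairCode x ≤_) (sym act-code) ∘ Equivalence.from lex)
    where
    x = ((i , j) , (i' , j'))
    w = proj₁ (conj (k , t) (i , j))
    w' = proj₁ (conj (k , t) (i' , j'))
    act-code : pairCode (act (k , t) x) ≡ (w + n * j) * (2 * n) + (w' + n * j')
    act-code = cong₂ (λ a b → (w + n * a) * (2 * n) + (w' + n * b))
                     (conj-preserves-kind {k} {t} {i} t<2 j<2) (conj-preserves-kind {k} {t} {i'} t<2 j'<2)
    lex : pairCode x ≤ (w + n * j) * (2 * n) + (w' + n * j') ⇔ (i , i') ≤ₗₑₓ (w , w')
    lex = ≤ₗₑₓ-+ʳ (n * j) (n * j') ⇔-∘ *+-≤⇔≤ₗₑₓ (code<2n i'<n j'<2) (code<2n (m%n<n _ n) j'<2)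

  isOrbitRep⇔Minimal : ∀ {i j i' j'} → i' < n → j < 2 → j' < 2 →
                       T (isOrbitRep ((i , j) , (i' , j'))) ⇔ Minimal ((i , j) , (i' , j'))
  isOrbitRep⇔Minimal {i} {j} {i'} {j'} i'<n j<2 j'<2 = mk⇔ to from
    where
    x = ((i , j) , (i' , j'))
    below⇔ : ∀ {k} t → t < 2 → T (pairCode x ≤ᵇ pairCode (act (k , t) x)) ⇔ ConjBelow x (k , t)
    below⇔ {k} t t<2 = pairCode-≤⇔ConjBelow {k = k} i'<n j<2 j'<2 t<2 ⇔-∘ mk⇔ (≤ᵇ⇒≤ (pairCode x) _) ≤⇒≤ᵇ
    to : T (isOrbitRep x) → Minimal x
    to rep k k<n with Equivalence.to All-elements⇔ (all⁺ _ elements rep) k k<n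
    ... | below₀ , below₁ = Equivalence.to (below⇔ {k} 0 (s≤s z≤n)) below₀ , Equivalence.to (below⇔ {k} 1 ≤-refl) below₁
    from : Minimal x → T (isOrbitRep x)
    from min = all⁻ _ (Equivalence.from All-elements⇔ λ k k<n →
      Equivalence.from (below⇔ {k} 0 (s≤s z≤n)) (proj₁ (min k k<n)) , Equivalence.from (below⇔ {k} 1 ≤-refl) (proj₂ (min k k<n)))

  conj-reflection : ∀ {k t} x → k ≤ n → t < 2 → proj₁ (conj (k , t) (x , 1)) + r * k ≋ sp t * x
  conj-reflection {t = 0} x k≤n _ = trans (conj-reflection-by-rotation x k≤n) (≡⇒≋ (sym (*-identityˡ x)))
  conj-reflection {t = 1} x k≤n _ = conj-reflection-by-reflection x k≤n
  conj-reflection {t = 2+ _} _ _ (s<s (s<s ()))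

  conj-reflection-determined : ∀ {k l t} i x → k ≤ n → l ≤ n → t < 2 →
                               proj₁ (conj (k , t) (i , 1)) ≡ proj₁ (conj (l , t) (i , 1)) →
                               proj₁ (conj (k , t) (x , 1)) ≡ proj₁ (conj (l , t) (x , 1))
  conj-reflection-determined {k} {l} {t} i x k≤n l≤n t<2 agree-on-i =
    ≋⇒≡ (+-cancelʳ-≋ (r * k) (begin
      (proj₁ (conj (k , t) (x , 1)) + r * k) % n    ≡⟨ conj-reflection x k≤n t<2 ⟩
      (sp t * x) % n                                ≡⟨ conj-reflection x l≤n t<2 ⟨
      (proj₁ (conj (l , t) (x , 1)) + r * l) % n    ≡⟨ ≋-+ {proj₁ (conj (l , t) (x , 1))} refl rl≋rk ⟩
      (proj₁ (conj (l , t) (x , 1)) + r * k) % n    ∎)) (m%n<n _ n) (m%n<n _ n)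
    where
    open ≡-Reasoning
    rl≋rk : r * l ≋ r * k
    rl≋rk = +-cancelˡ-≋ (proj₁ (conj (l , t) (i , 1)))
              (trans (conj-reflection i l≤n t<2)
                (trans (sym (conj-reflection i k≤n t<2)) (≡⇒≋ (cong (_+ r * k) agree-on-i))))

  conj-by-a⁰ : ∀ {x} → x < n → proj₁ (conj (0 , 0) (x , 1)) ≡ x
  conj-by-a⁰ {x} x<n = ≋⇒≡ (trans (≡⇒≋ w≡w+r*0) (conj-reflection-by-rotation x z≤n)) (m%n<n _ n) x<n
    where
    w = proj₁ (conj (0 , 0) (x , 1))
    w≡w+r*0 : w ≡ w + r * 0
    w≡w+r*0 = sym (trans (cong (w +_) (*-zeroʳ r)) (+-identityʳ w))

  conj-reflection-self : ∀ {i} → i < n → proj₁ (conj (i , 1) (i , 1)) ≡ i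
  conj-reflection-self {i} i<n = ≋⇒≡ (+-cancelʳ-≋ (r * i) (conj-reflection-by-reflection i (<⇒≤ i<n))) (m%n<n _ n) i<n

  reflection-%τ : ∀ {k t} i → k ≤ n → t < 2 → proj₁ (conj (k , t) (i , 1)) % τ ≡ i % τ
  reflection-%τ {k} {0} i k≤n _ = %τ-invariant k 0 (trans (conj-reflection-by-rotation i k≤n)
                                                           (≡⇒≋ (sym (trans (cong (i +_) (*-zeroʳ r)) (+-identityʳ i)))))
  reflection-%τ {k} {1} i k≤n _ = %τ-invariant k i (conj-reflection-by-reflection i k≤n)
  reflection-%τ {t = 2+ _} _ _ (s<s (s<s ()))

  <τ⇒conj-reflection-≥ : ∀ {k t i} → i < τ → k ≤ n → t < 2 → i ≤ proj₁ (conj (k , t) (i , 1))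
  <τ⇒conj-reflection-≥ {k} {t} {i} i<τ k≤n t<2 =
    ≤-trans (≤-reflexive (trans (sym (m<n⇒m%n≡m i<τ)) (sym (reflection-%τ i k≤n t<2)))) (m%n≤m _ τ)

  conj-reflection-reaches-%τ : ∀ {i} → i < n → ∃ λ k → k < n × proj₁ (conj (k , 0) (i , 1)) ≡ i % τ
  conj-reflection-reaches-%τ {i} i<n =
    let k , k<n , i%τ+rk≋i = reach-%τ i in
    k , k<n , ≋⇒≡ (+-cancelʳ-≋ (r * k) (trans (conj-reflection-by-rotation i (<⇒≤ k<n)) (sym i%τ+rk≋i)))
                  (m%n<n _ n) (<-≤-trans (m%n<n i τ) (∣⇒≤ τ∣n))

  conj-reflection-≥⇒<τ : ∀ {i} → i < n → (∀ k → k < n → i ≤ proj₁ (conj (k , 0) (i , 1))) → i < τ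
  conj-reflection-≥⇒<τ {i} i<n least =
    let k , k<n , w≡i%τ = conj-reflection-reaches-%τ i<n in
    ≰⇒> λ τ≤i → <⇒≱ (<-≤-trans (m%n<n i τ) τ≤i) (≤-trans (least k k<n) (≤-reflexive w≡i%τ))

  -- φ x ≡ s x − r c (mod n): the action σ of any reflection on rotations (c = 0)
  -- and the action ρ c of a^c b on reflections both have this form.
  module AffineInvolution (c : ℕ) (φ : ℕ → ℕ) (φ<n : ∀ x → φ x < n) (φ-spec : ∀ x → φ x + r * c ≋ s * x) where

    φ-involutive : ∀ x → x < n → φ (φ x) ≡ x
    φ-involutive x x<n = ≋⇒≡ (+-cancelʳ-≋ c (begin
      (φ (φ x) + c) % n                      ≡⟨ ≡⇒≋ (cong (φ (φ x) +_) (*-identityˡ c)) ⟨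
      (φ (φ x) + 1 * c) % n                  ≡⟨ ≋-+ {φ (φ x)} refl (≋-* {s * s} {1} {c} s²≋1 refl) ⟨
      (φ (φ x) + s * s * c) % n              ≡⟨ ≡⇒≋ (solve 3 (λ z r c → z :+ (con 1 :+ r) :* (con 1 :+ r) :* c
                                                               := z :+ r :* c :+ ((con 1 :+ r) :* (r :* c) :+ c)) refl (φ (φ x)) r c) ⟩
      (φ (φ x) + r * c + (s * (r * c) + c)) % n  ≡⟨ ≋-+ {φ (φ x) + r * c} (φ-spec (φ x)) refl ⟩
      (s * φ x + (s * (r * c) + c)) % n      ≡⟨ ≡⇒≋ (solve 4 (λ y s r c → s :* y :+ (s :* (r :* c) :+ c) := s :* (y :+ r :* c) :+ c) refl (φ x) s r c) ⟩
      (s * (φ x + r * c) + c) % n            ≡⟨ ≋-+ {s * (φ x + r * c)} (≋-* {s} refl (φ-spec x)) refl ⟩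
      (s * (s * x) + c) % n                  ≡⟨ ≡⇒≋ (cong (_+ c) (sym (*-assoc s s x))) ⟩
      (s * s * x + c) % n                    ≡⟨ ≋-+ {s * s * x} (≋-* {s * s} {1} {x} s²≋1 refl) refl ⟩
      (1 * x + c) % n                        ≡⟨ ≡⇒≋ (cong (_+ c) (*-identityˡ x)) ⟩
      (x + c) % n                            ∎)) (φ<n (φ x)) x<n
      where open ≡-Reasoning

    fixed⇔ : ∀ x → x < n → x ≡ φ x ⇔ r * x ≋ r * c
    fixed⇔ x x<n = mk⇔ to from
      where
      to : x ≡ φ x → r * x ≋ r * c
      to x≡φx = sym (+-cancelˡ-≋ x (subst (λ y → y + r * c ≋ s * x) (sym x≡φx) (φ-spec x)))
      from : r * x ≋ r * c → x ≡ φ x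
      from rx≋rc = ≋⇒≡ (+-cancelʳ-≋ (r * c) (trans (≋-+ {x} refl (sym rx≋rc)) (sym (φ-spec x)))) x<n (φ<n x)

    open Involution (λ x _ → φ<n x) φ-involutive public

    countFix≡τ : countFix ≡ τ
    countFix≡τ = trans (∑-cong n (λ x x<n → 𝟙-cong (fixed⇔ x x<n) (x ≟ φ x) _)) (count-r*≋ c)

    count≤+count≤≡n+τ : count≤ + count≤ ≡ n + τ
    count≤+count≤≡n+τ = trans count≤+count≤ (cong (n +_) countFix≡τ)

    count<+count<+τ≡n : count< + count< + τ ≡ n
    count<+count<+τ≡n = trans (cong (count< + count< +_) (sym countFix≡τ)) count<+count<+countFix

    count<+τ≡count≤ : count< + τ ≡ count≤
    count<+τ≡count≤ = sym (trans count≤≡count<+countFix (cong (count< +_) countFix≡τ))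

  σ-spec : ∀ x → σ x + r * 0 ≋ s * x
  σ-spec x = trans (≡⇒≋ (trans (cong (σ x +_) (*-zeroʳ r)) (+-identityʳ (σ x)))) (%-≋ (s * x))

  module Rotations = AffineInvolution 0 σ (λ x → m%n<n (s * x) n) σ-spec

  ρ : ℕ → ℕ → ℕ
  ρ i x = proj₁ (conj (i , 1) (x , 1))

  module Reflections {i} (i<n : i < n) =
    AffineInvolution i (ρ i) (λ x → m%n<n _ n) (λ x → conj-reflection-by-reflection x (<⇒≤ i<n))

  reflections-count≤≡rotations-count≤ : ∀ {i} (i<n : i < n) → Reflections.count≤ i<n ≡ Rotations.count≤
  reflections-count≤≡rotations-count≤ i<n = begin
    Reflections.count≤ i<n
      ≡⟨ n≡⌊n+n/2⌋ _ ⟩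
    ⌊ Reflections.count≤ i<n + Reflections.count≤ i<n /2⌋
      ≡⟨ cong ⌊_/2⌋ (trans (Reflections.count≤+count≤≡n+τ i<n) (sym Rotations.count≤+count≤≡n+τ)) ⟩
    ⌊ Rotations.count≤ + Rotations.count≤ /2⌋
      ≡⟨ n≡⌊n+n/2⌋ _ ⟨
    Rotations.count≤
      ∎
    where open ≡-Reasoning

  private
    0<n : 0 < n
    0<n = >-nonZero⁻¹ n

  minimal₀₀⇔ : ∀ {i i'} → i < n → i' < n → Minimal ((i , 0) , (i' , 0)) ⇔ (i , i') ≤ₗₑₓ (σ i , σ i')
  minimal₀₀⇔ {i} {i'} i<n i'<n = mk⇔ to from
    where
    by-rotation : ∀ {k} → k ≤ n → (proj₁ (conj (k , 0) (i , 0)) , proj₁ (conj (k , 0) (i' , 0))) ≡ (i , i')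
    by-rotation k≤n = cong₂ _,_ (conj-rotation-by-rotation k≤n i<n) (conj-rotation-by-rotation k≤n i'<n)
    by-reflection : ∀ {k} → k ≤ n → (proj₁ (conj (k , 1) (i , 0)) , proj₁ (conj (k , 1) (i' , 0))) ≡ (σ i , σ i')
    by-reflection k≤n = cong₂ _,_ (conj-rotation-by-reflection i k≤n) (conj-rotation-by-reflection i' k≤n)
    to : Minimal ((i , 0) , (i' , 0)) → (i , i') ≤ₗₑₓ (σ i , σ i')
    to min = subst ((i , i') ≤ₗₑₓ_) (by-reflection z≤n) (proj₂ (min 0 0<n))
    from : (i , i') ≤ₗₑₓ (σ i , σ i') → Minimal ((i , 0) , (i' , 0))
    from ≤σ k k<n = subst ((i , i') ≤ₗₑₓ_) (sym (by-rotation (<⇒≤ k<n))) (inj₂ (refl , ≤-refl))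
                  , subst ((i , i') ≤ₗₑₓ_) (sym (by-reflection (<⇒≤ k<n))) ≤σ

  minimal₀₁⇔ : ∀ {i i'} → i < n → i' < n → Minimal ((i , 0) , (i' , 1)) ⇔ (i ≤ σ i × i' < τ)
  minimal₀₁⇔ {i} {i'} i<n i'<n = mk⇔ to from
    where
    to : Minimal ((i , 0) , (i' , 1)) → i ≤ σ i × i' < τ
    to min = ≤ₗₑₓ⇒≤₁ (subst (λ w → (i , i') ≤ₗₑₓ (w , _)) (conj-rotation-by-reflection i z≤n) (proj₂ (min 0 0<n)))
           , conj-reflection-≥⇒<τ i'<n (λ k k<n →
               ≤ₗₑₓ⇒≤₂ (subst (λ w → (i , i') ≤ₗₑₓ (w , _)) (conj-rotation-by-rotation (<⇒≤ k<n) i<n) (proj₁ (min k k<n))))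
    from : i ≤ σ i × i' < τ → Minimal ((i , 0) , (i' , 1))
    from (i≤σi , i'<τ) k k<n =
        subst (λ w → (i , i') ≤ₗₑₓ (w , _)) (sym (conj-rotation-by-rotation (<⇒≤ k<n) i<n))
              (inj₂ (refl , <τ⇒conj-reflection-≥ i'<τ (<⇒≤ k<n) (s≤s z≤n)))
      , subst (λ w → (i , i') ≤ₗₑₓ (w , _)) (sym (conj-rotation-by-reflection i (<⇒≤ k<n)))
              (≤ₗₑₓ-intro i≤σi (λ _ → <τ⇒conj-reflection-≥ i'<τ (<⇒≤ k<n) ≤-refl))

  minimal₁₀⇔ : ∀ {i i'} → i < n → i' < n → Minimal ((i , 1) , (i' , 0)) ⇔ (i < τ × i' ≤ σ i')
  minimal₁₀⇔ {i} {i'} i<n i'<n = mk⇔ to from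
    where
    to : Minimal ((i , 1) , (i' , 0)) → i < τ × i' ≤ σ i'
    to min = conj-reflection-≥⇒<τ i<n (λ k k<n → ≤ₗₑₓ⇒≤₁ (proj₁ (min k k<n)))
           , ≤ₗₑₓ⇒≤₂ (subst₂ (λ w w' → (i , i') ≤ₗₑₓ (w , w'))
                              (conj-reflection-self i<n) (conj-rotation-by-reflection i' (<⇒≤ i<n)) (proj₂ (min i i<n)))
    from : i < τ × i' ≤ σ i' → Minimal ((i , 1) , (i' , 0))
    from (i<τ , i'≤σi') k k<n =
        ≤ₗₑₓ-intro (<τ⇒conj-reflection-≥ i<τ (<⇒≤ k<n) (s≤s z≤n))
                   (λ _ → ≤-reflexive (sym (conj-rotation-by-rotation (<⇒≤ k<n) i'<n)))
      , ≤ₗₑₓ-intro (<τ⇒conj-reflection-≥ i<τ (<⇒≤ k<n) ≤-refl)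
                   (λ _ → ≤-trans i'≤σi' (≤-reflexive (sym (conj-rotation-by-reflection i' (<⇒≤ k<n)))))

  minimal₁₁⇔ : ∀ {i i'} → i < n → i' < n → Minimal ((i , 1) , (i' , 1)) ⇔ (i < τ × i' ≤ ρ i i')
  minimal₁₁⇔ {i} {i'} i<n i'<n = mk⇔ to from
    where
    to : Minimal ((i , 1) , (i' , 1)) → i < τ × i' ≤ ρ i i'
    to min = conj-reflection-≥⇒<τ i<n (λ k k<n → ≤ₗₑₓ⇒≤₁ (proj₁ (min k k<n)))
           , ≤ₗₑₓ⇒≤₂ (subst (λ w → (i , i') ≤ₗₑₓ (w , ρ i i')) (conj-reflection-self i<n) (proj₂ (min i i<n)))
    -- a conjugator that fixes a^i b acts on a^i' b as a⁰ resp. a^i b does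
    from : i < τ × i' ≤ ρ i i' → Minimal ((i , 1) , (i' , 1))
    from (i<τ , i'≤ρ) k k<n =
        ≤ₗₑₓ-intro (<τ⇒conj-reflection-≥ i<τ (<⇒≤ k<n) (s≤s z≤n)) (λ i≡w → ≤-reflexive (sym (trans
          (conj-reflection-determined i i' (<⇒≤ k<n) z≤n (s≤s z≤n) (trans (sym i≡w) (sym (conj-by-a⁰ i<n))))
          (conj-by-a⁰ i'<n))))
      , ≤ₗₑₓ-intro (<τ⇒conj-reflection-≥ i<τ (<⇒≤ k<n) ≤-refl) (λ i≡w → ≤-trans i'≤ρ (≤-reflexive (sym
          (conj-reflection-determined i i' (<⇒≤ k<n) (<⇒≤ i<n) ≤-refl (trans (sym i≡w) (sym (conj-reflection-self i<n)))))))

  𝟙-rep : Elt × Elt → ℕ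
  𝟙-rep x = 𝟙 (T? (isOrbitRep x))

  repCount : ℕ → ℕ → ℕ
  repCount j j' = ∑[ i < n ] ∑[ i' < n ] 𝟙-rep ((i , j) , (i' , j'))

  𝟙-rep-cong : ∀ {i j i' j'} {P : Set} → i' < n → j < 2 → j' < 2 →
               Minimal ((i , j) , (i' , j')) ⇔ P → (P? : Dec P) → 𝟙-rep ((i , j) , (i' , j')) ≡ 𝟙 P?
  𝟙-rep-cong i'<n j<2 j'<2 minimal⇔P = 𝟙-cong (minimal⇔P ⇔-∘ isOrbitRep⇔Minimal i'<n j<2 j'<2) _

  repCount₀₀ : repCount 0 0 ≡ n * Rotations.count< + τ * Rotations.count≤
  repCount₀₀ = begin
    repCount 0 0
      ≡⟨ ∑-cong n (λ i i<n → ∑-cong n (λ i' i'<n → 𝟙-rep-cong i'<n (s≤s z≤n) (s≤s z≤n) (minimal₀₀⇔ i<n i'<n) _)) ⟩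
    ∑[ i < n ] ∑[ i' < n ] 𝟙 ((i , i') ≤ₗₑₓ? (σ i , σ i'))
      ≡⟨ ∑-cong n (λ i _ → ∑-cong n (λ i' _ → trans (𝟙-⊎ (λ i<σi → <⇒≢ i<σi ∘ proj₁) (i <? σ i) _)
                                                   (cong (𝟙 (i <? σ i) +_) (𝟙-× (i ≟ σ i) (i' ≤? σ i'))))) ⟩
    ∑[ i < n ] ∑[ i' < n ] (𝟙 (i <? σ i) + 𝟙 (i ≟ σ i) * 𝟙 (i' ≤? σ i'))
      ≡⟨ ∑-cong n (λ i _ → trans (∑-distrib-+ n _ _)
                                 (cong₂ _+_ (∑-const n _) (*-distribˡ-∑ n (𝟙 (i ≟ σ i)) (λ i' → 𝟙 (i' ≤? σ i'))))) ⟩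
    ∑[ i < n ] (n * 𝟙 (i <? σ i) + 𝟙 (i ≟ σ i) * Rotations.count≤)
      ≡⟨ trans (∑-distrib-+ n _ _) (cong₂ _+_ (*-distribˡ-∑ n n _) (*-distribʳ-∑ n Rotations.count≤ _)) ⟩
    n * Rotations.count< + Rotations.countFix * Rotations.count≤
      ≡⟨ cong (λ f → n * Rotations.count< + f * Rotations.count≤) Rotations.countFix≡τ ⟩
    n * Rotations.count< + τ * Rotations.count≤
      ∎
    where open ≡-Reasoning

  repCount₀₁ : repCount 0 1 ≡ Rotations.count≤ * τ
  repCount₀₁ = begin
    repCount 0 1
      ≡⟨ ∑-cong n (λ i i<n → ∑-cong n (λ i' i'<n → 𝟙-rep-cong i'<n (s≤s z≤n) ≤-refl (minimal₀₁⇔ i<n i'<n) _)) ⟩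
    ∑[ i < n ] ∑[ i' < n ] 𝟙 ((i ≤? σ i) ×-dec (i' <? τ))
      ≡⟨ ∑-cong n (λ i _ → ∑-𝟙-× n (i ≤? σ i) (_<? τ)) ⟩
    ∑[ i < n ] (𝟙 (i ≤? σ i) * ∑[ i' < n ] 𝟙 (i' <? τ))
      ≡⟨ *-distribʳ-∑ n _ _ ⟩
    Rotations.count≤ * ∑[ i' < n ] 𝟙 (i' <? τ)
      ≡⟨ cong (Rotations.count≤ *_) (count-< (∣⇒≤ τ∣n)) ⟩
    Rotations.count≤ * τ
      ∎
    where open ≡-Reasoning

  repCount₁₀ : repCount 1 0 ≡ τ * Rotations.count≤
  repCount₁₀ = begin
    repCount 1 0
      ≡⟨ ∑-cong n (λ i i<n → ∑-cong n (λ i' i'<n → 𝟙-rep-cong i'<n ≤-refl (s≤s z≤n) (minimal₁₀⇔ i<n i'<n) _)) ⟩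
    ∑[ i < n ] ∑[ i' < n ] 𝟙 ((i <? τ) ×-dec (i' ≤? σ i'))
      ≡⟨ ∑-cong n (λ i _ → ∑-𝟙-× n (i <? τ) (λ i' → i' ≤? σ i')) ⟩
    ∑[ i < n ] (𝟙 (i <? τ) * Rotations.count≤)
      ≡⟨ *-distribʳ-∑ n _ _ ⟩
    ∑[ i < n ] 𝟙 (i <? τ) * Rotations.count≤
      ≡⟨ cong (_* Rotations.count≤) (count-< (∣⇒≤ τ∣n)) ⟩
    τ * Rotations.count≤
      ∎
    where open ≡-Reasoning

  repCount₁₁ : repCount 1 1 ≡ τ * Rotations.count≤
  repCount₁₁ = begin
    repCount 1 1
      ≡⟨ ∑-cong n (λ i i<n → ∑-cong n (λ i' i'<n → 𝟙-rep-cong i'<n ≤-refl ≤-refl (minimal₁₁⇔ i<n i'<n) _)) ⟩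
    ∑[ i < n ] ∑[ i' < n ] 𝟙 ((i <? τ) ×-dec (i' ≤? ρ i i'))
      ≡⟨ ∑-cong n (λ i i<n → trans (∑-𝟙-× n (i <? τ) (λ i' → i' ≤? ρ i i'))
                                   (cong (𝟙 (i <? τ) *_) (reflections-count≤≡rotations-count≤ i<n))) ⟩
    ∑[ i < n ] (𝟙 (i <? τ) * Rotations.count≤)
      ≡⟨ *-distribʳ-∑ n _ _ ⟩
    ∑[ i < n ] 𝟙 (i <? τ) * Rotations.count≤
      ≡⟨ cong (_* Rotations.count≤) (count-< (∣⇒≤ τ∣n)) ⟩
    τ * Rotations.count≤
      ∎
    where open ≡-Reasoning

  sum-map-elements : ∀ (F : Elt → ℕ) → sum (map F elements) ≡ ∑[ i < n ] F (i , 0) + ∑[ i < n ] F (i , 1)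
  sum-map-elements F = begin
    sum (map F elements)                                       ≡⟨ sum-map-concatMap F (λ j → map (λ i → (i , j)) (upTo n)) (upTo 2) ⟩
    sum (map F (map (_, 0) (upTo n))) + (sum (map F (map (_, 1) (upTo n))) + 0)
                                                               ≡⟨ cong₂ (λ a b → a + (b + 0)) (sum-map-upTo n F (_, 0)) (sum-map-upTo n F (_, 1)) ⟩
    ∑[ i < n ] F (i , 0) + (∑[ i < n ] F (i , 1) + 0)          ≡⟨ cong (∑[ i < n ] F (i , 0) +_) (+-identityʳ _) ⟩
    ∑[ i < n ] F (i , 0) + ∑[ i < n ] F (i , 1)                ∎
    where open ≡-Reasoning

  dim≡∑repCount : dimCentralizerAlgebra ≡ repCount 0 0 + repCount 0 1 + (repCount 1 0 + repCount 1 1)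
  dim≡∑repCount = begin
    length (filterᵇ isOrbitRep pairs)
      ≡⟨ length-filterᵇ isOrbitRep pairs ⟩
    sum (map 𝟙-rep pairs)
      ≡⟨ sum-map-concatMap 𝟙-rep (λ u → map (u ,_) elements) elements ⟩
    sum (map (λ u → sum (map 𝟙-rep (map (u ,_) elements))) elements)
      ≡⟨ cong sum (map-cong (λ u → cong sum (map-∘ elements)) elements) ⟨
    sum (map (λ u → sum (map (λ v → 𝟙-rep (u , v)) elements)) elements)
      ≡⟨ sum-map-elements _ ⟩
    ∑[ i < n ] sum (map (λ v → 𝟙-rep ((i , 0) , v)) elements) + ∑[ i < n ] sum (map (λ v → 𝟙-rep ((i , 1) , v)) elements)
      ≡⟨ cong₂ _+_ (∑-cong n (λ i _ → sum-map-elements _)) (∑-cong n (λ i _ → sum-map-elements _)) ⟩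
    ∑[ i < n ] (∑[ i' < n ] 𝟙-rep ((i , 0) , (i' , 0)) + ∑[ i' < n ] 𝟙-rep ((i , 0) , (i' , 1)))
      + ∑[ i < n ] (∑[ i' < n ] 𝟙-rep ((i , 1) , (i' , 0)) + ∑[ i' < n ] 𝟙-rep ((i , 1) , (i' , 1)))
      ≡⟨ cong₂ _+_ (∑-distrib-+ n _ _) (∑-distrib-+ n _ _) ⟩
    repCount 0 0 + repCount 0 1 + (repCount 1 0 + repCount 1 1)
      ∎
    where open ≡-Reasoning

lemma3p2 : (n s : ℕ) .{{_ : NonZero n}} → 3 ≤ n → 1 ≤ s → (s * s) % n ≡ 1 % n → s % n ≢ 1 % n →
    2 * Dns.dimCentralizerAlgebra n s ≡ n * n + 3 * n * gcd (s ∸ 1) n + 4 * (gcd (s ∸ 1) n * gcd (s ∸ 1) n)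
lemma3p2 n (suc r) _ _ s²≡1 _ = begin
  2 * dimCentralizerAlgebra
    ≡⟨ cong (2 *_) dim≡∑repCount ⟩
  2 * (repCount 0 0 + repCount 0 1 + (repCount 1 0 + repCount 1 1))
    ≡⟨ cong (2 *_) (cong₂ _+_ (cong₂ _+_ repCount₀₀ repCount₀₁) (cong₂ _+_ repCount₁₀ repCount₁₁)) ⟩
  2 * (n * count< + τ * count≤ + count≤ * τ + (τ * count≤ + τ * count≤))
    ≡⟨ dimension-arithmetic count< τ count<+count<+τ≡n count<+τ≡count≤ ⟩
  n * n + 3 * n * τ + 4 * (τ * τ)
    ∎
  where
  open Dns n (suc r) using (dimCentralizerAlgebra)
  open Multiples n r using (τ)
  open Orbits n r s²≡1
  open Rotations using (count<; count≤; count<+count<+τ≡n; count<+τ≡count≤)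
  open ≡-Reasoning
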